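{- Let $w,\hat w\in S_n$. If $w^{ -1}$ and $\hat w^{ -1}$ (as words $w^{ -1}(1)\dots w^{ -1}(n)$ and $\hat w^{ -1}(1)\dots\hat w^{ -1}(n)$) have the same insertion tableau, then $w^*$ is equivalent to $\hat w^*$.
   Context: For $w\in S_n$, $w^*$ is the infinite periodic sequence $a_1a_2\dots a_n\,a_1a_2\dots a_n\,a_1\dots$ with $a_i=w^{ -1}(i)$. Insertion tableau means the RSK (row-insertion) tableau of the word. Strict Knuth transformations on a sequence $a_1a_2\dots$ of integers: $\kappa_k$ replaces $a_ka_{k+1}a_{k+2}$ by $a_ka_{k+2}a_{k+1}$ if $a_{k+1}<a_k<a_{k+2}$ or $a_{k+2}<a_k<a_{k+1}$, by $a_{k+1}a_ka_{k+2}$ if $a_k<a_{k+2}<a_{k+1}$ or $a_{k+1}<a_{k+2}<a_k$, and is undefined otherwise (other terms unchanged). Two infinite sequences $a,b$ are equivalent if for every $N\ge0$ there are strict Knuth transformations $\kappa_{k_1},\dots,\kappa_{k_r}$ (all defined) such that the first $N$ terms of $\kappa_{k_1}\circ\dots\circ\kappa_{k_r}(a)$ equal the first $N$ terms of $b$. -}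

module Defs where

open import Data.Nat using (ℕ; zero; suc; _<_; _<ᵇ_; _≟_; NonZero)
open import Data.Nat.DivMod using (_%_; m%n<n)
open import Data.Fin using (Fin; toℕ; fromℕ<)
open import Data.Fin.Permutation using (Permutation′; _⟨$⟩ˡ_)
open import Data.List using (List; []; _∷_; [_]; map; foldl)
open import Data.List.Base using (allFin)
open import Data.Maybe using (Maybe; just; nothing)
open import Data.Product using (_×_; _,_; ∃; ∃-syntax)
open import Data.Sum using (_⊎_)
open import Data.Bool using (true; false)
open import Relation.Nullary using (yes; no)
open import Relation.Binary.PropositionalEquality using (_≡_)
open import Relation.Binary.Construct.Closure.ReflexiveTransitive using (Star)

-- Infinite sequences of integers (positions indexed from 0).
Seq : Set
Seq = ℕ → ℕ

rowIns : ℕ → List ℕ → List ℕ × Maybe ℕ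
rowIns x [] = [ x ] , nothing
rowIns x (y ∷ ys) with x <ᵇ y
... | true  = x ∷ ys , just y
... | false with rowIns x ys
...   | r , b = y ∷ r , b

-- Row insertion of x into a tableau (list of rows, top row first).
tabIns : ℕ → List (List ℕ) → List (List ℕ)
tabIns x [] = [ [ x ] ] 
tabIns x (r ∷ rs) with rowIns x r
... | r' , nothing = r' ∷ rs
... | r' , just y  = r' ∷ tabIns y rs

insertionTableau : List ℕ → List (List ℕ)
insertionTableau = foldl (λ t x → tabIns x t) []

-- a_i = w⁻¹(i), with values in {1,…,n}; Fin index i stands for i+1.
invLetter : ∀ {n} → Permutation′ n → Fin n → ℕ
invLetter w i = suc (toℕ (w ⟨$⟩ˡ i))

invWord : ∀ {n} → Permutation′ n → List ℕ
invWord {n} w = map (invLetter w) (allFin n)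

-- w* = a₁ … a_n a₁ … a_n …  ; position m (from 0) holds a_{(m mod n)+1}.
periodic : ∀ {n} .{{_ : NonZero n}} → Permutation′ n → Seq
periodic {n} w m = invLetter w (fromℕ< (m%n<n m n))

-- Strict Knuth transformations (position k here is the paper's k+1)

swapAt : ℕ → ℕ → Seq → Seq
swapAt i j a m with m ≟ i
... | yes _ = a j
... | no _ with m ≟ j
...   | yes _ = a i
...   | no _  = a m

_≗_ : Seq → Seq → Set
a ≗ b = ∀ m → a m ≡ b m

-- κ_k a is defined and (pointwise) equal to b.
data Kappa (k : ℕ) (a b : Seq) : Set where
  swapLast  : ((a (suc k) < a k × a k < a (suc (suc k)))
                 ⊎ (a (suc (suc k)) < a k × a k < a (suc k)))
            → b ≗ swapAt (suc k) (suc (suc k)) a → Kappa k a b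
  swapFirst : ((a k < a (suc (suc k)) × a (suc (suc k)) < a (suc k))
                 ⊎ (a (suc k) < a (suc (suc k)) × a (suc (suc k)) < a k))
            → b ≗ swapAt k (suc k) a → Kappa k a b

KnuthStep : Seq → Seq → Set
KnuthStep a b = ∃[ k ] Kappa k a b

Equivalent : Seq → Seq → Set
Equivalent a b = ∀ (N : ℕ) → ∃[ c ] (Star KnuthStep a c × (∀ i → i < N → c i ≡ b i))

module Submission where

-- Let ≈K be the equivalence on finite words generated by Knuth moves, the finite
-- counterpart of the strict Knuth transformations κ_k.  The proof has three parts.
--   1. Knuth's theorem for words with distinct letters: a word is ≈K-equivalent to
--      the reading word of its insertion tableau.  Inserting x into an increasing
--      row r either appends x or bumps a letter y, and then r x ≈K y r'; row by row
--      this gives read(T) x ≈K read(T ← x), and letter by letter a ≈K read(P(a)).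
--      Equal tableaux therefore give w⁻¹ ≈K ŵ⁻¹.
--   2. A Knuth move performed inside a window of an infinite sequence is a strict
--      Knuth transformation of the sequence that leaves it unchanged outside the
--      window.
--   3. w* is the concatenation of copies of the word w⁻¹.  Rewriting these blocks
--      into ŵ⁻¹ one after the other turns w* into sequences agreeing with ŵ* on
--      arbitrarily long prefixes.

open import Defs
open import Relation.Binary.PropositionalEquality using (_≡_; _≢_; refl; sym; trans; cong; subst; ≢-sym; setoid)
open import Data.Nat using (ℕ; NonZero; zero; suc; _<_; _≤_; _+_; _*_; _<ᵇ_; _<?_; _≟_)
open import Data.Nat.Properties
open import Data.Nat.DivMod using (_%_; [m+kn]%n≡m%n; m<n⇒m%n≡m)
open import Data.Fin using (Fin; toℕ) renaming (zero to fzero; suc to fsuc)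
open import Data.Fin.Properties using (toℕ-injective; toℕ-fromℕ<; toℕ<n)
open import Data.Fin.Permutation using (Permutation′; _⟨$⟩ˡ_; _⟨$⟩ʳ_; inverseʳ)
open import Data.List using (List; []; _∷_; [_]; _++_; foldl; length; tabulate; allFin)
open import Data.List.Properties using (++-assoc; ++-identityʳ; length-map; length-tabulate; map-tabulate)
open import Data.List.Relation.Unary.All as All using (All; []; _∷_)
import Data.List.Relation.Unary.All.Properties as All
open import Data.List.Relation.Unary.AllPairs using (AllPairs; []; _∷_)
open import Data.List.Relation.Unary.Unique.Propositional using (Unique)
import Data.List.Relation.Unary.Unique.Propositional.Properties as Unique
open import Data.List.Relation.Binary.Permutation.Propositional using (_↭_; prep; swap; ↭-refl; ↭-trans; ↭⇒↭ₛ)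
open import Data.List.Relation.Binary.Permutation.Propositional.Properties using (All-resp-↭; ↭-length)
open import Data.List.Relation.Binary.Permutation.Setoid.Properties (setoid ℕ) using (Unique-resp-↭)
open import Data.Maybe using (Maybe; just; nothing)
open import Data.Product using (_×_; _,_; ∃-syntax; proj₁; proj₂)
open import Data.Sum using (_⊎_; inj₁; inj₂)
open import Data.Bool using (true; false; T)
open import Data.Unit using (⊤; tt)
open import Function using (id; _∘_)
open import Relation.Nullary using (yes; no; contradiction)
open import Relation.Binary.Construct.Closure.ReflexiveTransitive using (Star; ε; _◅_; _◅◅_; gmap; reverse)
open import Relation.Binary.Construct.Closure.ReflexiveTransitive.Properties using (module StarReasoning)

-- x lies strictly between y and z.  Both kinds of strict Knuth transformation
-- are guarded by a condition of this form (see Kappa in Defs).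
Between : ℕ → ℕ → ℕ → Set
Between x y z = (y < x × x < z) ⊎ (z < x × x < y)

between-sym : ∀ {x y z} → Between x y z → Between x z y
between-sym (inj₁ (y<x , x<z)) = inj₂ (y<x , x<z)
between-sym (inj₂ (z<x , x<y)) = inj₁ (z<x , x<y)

-- A Knuth move on a finite word: the letters of a factor x y z are permuted
-- exactly as κ_k permutes them.
data KnuthMove : List ℕ → List ℕ → Set where
  swapLastTwo  : ∀ {x y z l} → Between x y z → KnuthMove (x ∷ y ∷ z ∷ l) (x ∷ z ∷ y ∷ l)
  swapFirstTwo : ∀ {x y z l} → Between z x y → KnuthMove (x ∷ y ∷ z ∷ l) (y ∷ x ∷ z ∷ l)
  skip         : ∀ {u v} x → KnuthMove u v → KnuthMove (x ∷ u) (x ∷ v)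

_≈K_ : List ℕ → List ℕ → Set
_≈K_ = Star KnuthMove

infix 4 _≈K_

open StarReasoning KnuthMove

move-sym : ∀ {u v} → KnuthMove u v → KnuthMove v u
move-sym (swapLastTwo b)  = swapLastTwo (between-sym b)
move-sym (swapFirstTwo b) = swapFirstTwo (between-sym b)
move-sym (skip x mv)      = skip x (move-sym mv)

≈K-sym : ∀ {u v} → u ≈K v → v ≈K u
≈K-sym = reverse move-sym

≡⇒≈K : ∀ {u v} → u ≡ v → u ≈K v
≡⇒≈K refl = ε

move⇒↭ : ∀ {u v} → KnuthMove u v → u ↭ v
move⇒↭ (swapLastTwo _)  = prep _ (swap _ _ ↭-refl)
move⇒↭ (swapFirstTwo _) = swap _ _ ↭-refl
move⇒↭ (skip x mv)      = prep x (move⇒↭ mv)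

≈K⇒↭ : ∀ {u v} → u ≈K v → u ↭ v
≈K⇒↭ ε           = ↭-refl
≈K⇒↭ (mv ◅ mvs) = ↭-trans (move⇒↭ mv) (≈K⇒↭ mvs)

unique-≈K : ∀ {u v} → u ≈K v → Unique u → Unique v
unique-≈K u≈v = Unique-resp-↭ (↭⇒↭ₛ (≈K⇒↭ u≈v))

≈K-++ˡ : ∀ p {u v} → u ≈K v → p ++ u ≈K p ++ v
≈K-++ˡ p = gmap (p ++_) (prefix p)
  where
  prefix : ∀ p {u v} → KnuthMove u v → KnuthMove (p ++ u) (p ++ v)
  prefix []      mv = mv
  prefix (x ∷ p) mv = skip x (prefix p mv)

≈K-++ʳ : ∀ s {u v} → u ≈K v → u ++ s ≈K v ++ s
≈K-++ʳ s = gmap (_++ s) suffix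
  where
  suffix : ∀ {u v} → KnuthMove u v → KnuthMove (u ++ s) (v ++ s)
  suffix (swapLastTwo b)  = swapLastTwo b
  suffix (swapFirstTwo b) = swapFirstTwo b
  suffix (skip x mv)      = skip x (suffix mv)

unique-prefix : ∀ (xs : List ℕ) {ys} → Unique (xs ++ ys) → Unique xs
unique-prefix []       _          = []
unique-prefix (x ∷ xs) (x∉ ∷ uniq) = All.++⁻ˡ xs x∉ ∷ unique-prefix xs uniq

unique-suffix : ∀ (xs : List ℕ) {ys} → Unique (xs ++ ys) → Unique ys
unique-suffix []       uniq       = uniq
unique-suffix (x ∷ xs) (_ ∷ uniq) = unique-suffix xs uniq

Row : List ℕ → Set
Row = AllPairs _<_

data HeadBelow (y : ℕ) : List ℕ → Set where
  headBelow : ∀ {h t} → h < y → HeadBelow y (h ∷ t)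

RowInsertion : ℕ → List ℕ → List ℕ × Maybe ℕ → Set
RowInsertion x r (r' , nothing) = r' ≡ r ++ [ x ] × Row r'
RowInsertion x r (r' , just y)  = r ++ [ x ] ≈K y ∷ r' × Row r' × x < y × HeadBelow y r'

<ᵇ-true : ∀ {x z} → (x <ᵇ z) ≡ true → x < z
<ᵇ-true {x} {z} cmp = <ᵇ⇒< x z (subst T (sym cmp) tt)

<ᵇ-false : ∀ {x z} → (x <ᵇ z) ≡ false → z ≢ x → z < x
<ᵇ-false cmp z≢x = ≤∧≢⇒< (≮⇒≥ (λ x<z → subst T cmp (<⇒<ᵇ x<z))) z≢x

bubble : ∀ x z zs → Row (z ∷ zs) → x < z → (z ∷ zs) ++ [ x ] ≈K z ∷ x ∷ zs
bubble x z []         _                      x<z = ε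
bubble x z (z₁ ∷ zs) ((z<z₁ ∷ _) ∷ row) x<z =
  ≈K-++ˡ [ z ] (bubble x z₁ zs row (<-trans x<z z<z₁))
  ◅◅ (swapLastTwo (inj₂ (x<z , z<z₁)) ◅ ε)

-- rowIns meets this specification on increasing rows when the letters of r x
-- are distinct (distinctness decides the comparisons strictly).
rowIns-spec : ∀ x r → Row r → Unique (r ++ [ x ]) → RowInsertion x r (rowIns x r)
rowIns-spec x [] _ _ = refl , [] ∷ []
rowIns-spec x (z ∷ zs) (z<zs ∷ row) (z≢ ∷ uniq) with x <ᵇ z in cmp
... | true = bubble x z zs (z<zs ∷ row) x<z , All.map (<-trans x<z) z<zs ∷ row
           , x<z , headBelow x<z
  where
  x<z : x < z
  x<z = <ᵇ-true cmp
... | false with rowIns x zs | rowIns-spec x zs row uniq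
...   | _ , nothing    | refl , row' = refl , All.++⁺ z<zs (z<x ∷ []) ∷ row'
  where
  z<x : z < x
  z<x = <ᵇ-false cmp (All.head (All.++⁻ʳ zs z≢))
...   | [] , just y     | _ , _ , _ , ()
...   | h ∷ t , just y | zsx≈ , row' , x<y , headBelow h<y =
  bumped , z<ht ∷ row' , x<y , headBelow (<-trans z<x x<y)
  where
  z<x : z < x
  z<x = <ᵇ-false cmp (All.head (All.++⁻ʳ zs z≢))
  -- the new row is a rearrangement of zs x, all of whose letters exceed z
  z<ht : All (z <_) (h ∷ t)
  z<ht = All.tail (All-resp-↭ (≈K⇒↭ zsx≈) (All.++⁺ z<zs (z<x ∷ [])))
  bumped : (z ∷ zs) ++ [ x ] ≈K y ∷ z ∷ h ∷ t
  bumped = begin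
    z ∷ zs ++ [ x ] ⟶*⟨ ≈K-++ˡ [ z ] zsx≈ ⟩
    z ∷ y ∷ h ∷ t   ⟶⟨ swapFirstTwo (inj₁ (All.head z<ht , h<y)) ⟩
    y ∷ z ∷ h ∷ t   ∎

readingWord : List (List ℕ) → List ℕ
readingWord []       = []
readingWord (r ∷ rs) = readingWord rs ++ r

tabIns-knuth : ∀ x T → All Row T → Unique (readingWord T ++ [ x ]) →
  readingWord T ++ [ x ] ≈K readingWord (tabIns x T) × All Row (tabIns x T)
tabIns-knuth x [] _ _ = ε , ([] ∷ []) ∷ []
tabIns-knuth x (r ∷ rs) (row ∷ rows) uniq
  with rowIns x r
     | rowIns-spec x r row (unique-suffix (readingWord rs) (subst Unique (++-assoc (readingWord rs) r [ x ]) uniq))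
... | _ , nothing | refl , row' = ≡⇒≈K (++-assoc (readingWord rs) r [ x ]) , row' ∷ rows
... | r' , just y | rx≈ , row' , _ = bumped ◅◅ ≈K-++ʳ r' (proj₁ below) , row' ∷ proj₂ below
  where
  bumped : (readingWord rs ++ r) ++ [ x ] ≈K (readingWord rs ++ [ y ]) ++ r'
  bumped = begin
    (readingWord rs ++ r) ++ [ x ]  ≡⟨ ++-assoc (readingWord rs) r [ x ] ⟩
    readingWord rs ++ r ++ [ x ]    ⟶*⟨ ≈K-++ˡ (readingWord rs) rx≈ ⟩
    readingWord rs ++ y ∷ r'        ≡⟨ ++-assoc (readingWord rs) [ y ] r' ⟨
    (readingWord rs ++ [ y ]) ++ r' ∎
  below : readingWord rs ++ [ y ] ≈K readingWord (tabIns y rs) × All Row (tabIns y rs)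
  below = tabIns-knuth y rs rows (unique-prefix (readingWord rs ++ [ y ]) (unique-≈K bumped uniq))

insertWord : List (List ℕ) → List ℕ → List (List ℕ)
insertWord = foldl (λ t x → tabIns x t)

insertWord-knuth : ∀ a T → All Row T → Unique (readingWord T ++ a) →
  readingWord T ++ a ≈K readingWord (insertWord T a)
insertWord-knuth []      T _    _    = ≡⇒≈K (++-identityʳ (readingWord T))
insertWord-knuth (x ∷ a) T rows uniq = begin
    readingWord T ++ x ∷ a         ≡⟨ ++-assoc (readingWord T) [ x ] a ⟨
    (readingWord T ++ [ x ]) ++ a  ⟶*⟨ ≈K-++ʳ a (proj₁ inserted) ⟩
    readingWord (tabIns x T) ++ a  ⟶*⟨ insertWord-knuth a (tabIns x T) (proj₂ inserted) uniq′ ⟩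
    readingWord (insertWord (tabIns x T) a) ∎
  where
  uniqₓ : Unique ((readingWord T ++ [ x ]) ++ a)
  uniqₓ = subst Unique (sym (++-assoc (readingWord T) [ x ] a)) uniq
  inserted : readingWord T ++ [ x ] ≈K readingWord (tabIns x T) × All Row (tabIns x T)
  inserted = tabIns-knuth x T rows (unique-prefix (readingWord T ++ [ x ]) uniqₓ)
  uniq′ : Unique (readingWord (tabIns x T) ++ a)
  uniq′ = unique-≈K (≈K-++ʳ a (proj₁ inserted)) uniqₓ

knuth : ∀ a → Unique a → a ≈K readingWord (insertionTableau a)
knuth a = insertWord-knuth a [] []

sameTableau⇒≈K : ∀ a b → Unique a → Unique b →
  insertionTableau a ≡ insertionTableau b → a ≈K b
sameTableau⇒≈K a b uniqa uniqb same = begin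
  a                                    ⟶*⟨ knuth a uniqa ⟩
  readingWord (insertionTableau a)     ≡⟨ cong readingWord same ⟩
  readingWord (insertionTableau b)     ⟶*⟨ ≈K-sym (knuth b uniqb) ⟩
  b                                    ∎

WordAt : ℕ → List ℕ → Seq → Set
WordAt o []      s = ⊤
WordAt o (x ∷ u) s = s o ≡ x × WordAt (suc o) u s

Outside : ℕ → ℕ → ℕ → Set
Outside o len m = m < o ⊎ o + len ≤ m

UnchangedOutside : ℕ → ℕ → Seq → Seq → Set
UnchangedOutside o len s t = ∀ m → Outside o len m → t m ≡ s m

outside-suc : ∀ {o len m} → Outside o (suc len) m → Outside (suc o) len m
outside-suc         (inj₁ m<o)  = inj₁ (m<n⇒m<1+n m<o)
outside-suc {o} {m = m} (inj₂ o+≤m) = inj₂ (subst (_≤ m) (+-suc o _) o+≤m)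

wordAt-cong : ∀ {o} u {s t : Seq} → (∀ i → o ≤ i → t i ≡ s i) → WordAt o u s → WordAt o u t
wordAt-cong []      same _          = tt
wordAt-cong {o} (x ∷ u) same (so≡x , occ) =
  trans (same o ≤-refl) so≡x , wordAt-cong u (λ i o<i → same i (<⇒≤ o<i)) occ

wordAt-agree : ∀ {o} u {s t : Seq} → WordAt o u s → WordAt o u t →
  ∀ i → o ≤ i → i < o + length u → s i ≡ t i
wordAt-agree {o} [] _ _ i o≤i i<o+0 = contradiction (subst (i <_) (+-identityʳ o) i<o+0) (≤⇒≯ o≤i)
wordAt-agree {o} (x ∷ u) (so≡x , occs) (to≡x , occt) i o≤i i< with m≤n⇒m<n∨m≡n o≤i
... | inj₂ refl = trans so≡x (sym to≡x)
... | inj₁ o<i  = wordAt-agree u occs occt i o<i (subst (i <_) (+-suc o (length u)) i<)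

swapAt-fst : ∀ i j (s : Seq) → swapAt i j s i ≡ s j
swapAt-fst i j s with i ≟ i
... | yes _  = refl
... | no i≢i = contradiction refl i≢i

swapAt-snd : ∀ i j (s : Seq) → i ≢ j → swapAt i j s j ≡ s i
swapAt-snd i j s i≢j with j ≟ i
... | yes j≡i = contradiction (sym j≡i) i≢j
... | no _ with j ≟ j
...   | yes _  = refl
...   | no j≢j = contradiction refl j≢j

swapAt-other : ∀ i j (s : Seq) m → m ≢ i → m ≢ j → swapAt i j s m ≡ s m
swapAt-other i j s m m≢i m≢j with m ≟ i
... | yes m≡i = contradiction m≡i m≢i
... | no _ with m ≟ j
...   | yes m≡j = contradiction m≡j m≢j
...   | no _    = refl

NotIn3 : ℕ → ℕ → Set
NotIn3 o m = m ≢ o × m ≢ suc o × m ≢ suc (suc o)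

o≢1+o : ∀ o → o ≢ 1 + o
o≢1+o o = <⇒≢ (n<1+n o)

o≢2+o : ∀ o → o ≢ 2 + o
o≢2+o o = <⇒≢ (m<n⇒m<1+n (n<1+n o))

below⇒notIn3 : ∀ {o m} → m < o → NotIn3 o m
below⇒notIn3 m<o = <⇒≢ m<o , <⇒≢ (m<n⇒m<1+n m<o) , <⇒≢ (m<n⇒m<1+n (m<n⇒m<1+n m<o))

above⇒notIn3 : ∀ {o m} → 3 + o ≤ m → NotIn3 o m
above⇒notIn3 {o} o+2<m = >⇒≢ (<-trans (n<1+n o) o+1<m) , >⇒≢ o+1<m , >⇒≢ o+2<m
  where
  o+1<m = <-trans (n<1+n (suc o)) o+2<m

rewriteWindow : ∀ o {x y z} l {s t : Seq} →
  t o ≡ x → t (1 + o) ≡ y → t (2 + o) ≡ z → (∀ m → NotIn3 o m → t m ≡ s m) →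
  WordAt (3 + o) l s → WordAt o (x ∷ y ∷ z ∷ l) t × UnchangedOutside o (3 + length l) s t
rewriteWindow o l {s} {t} tx ty tz same occ =
  (tx , ty , tz , wordAt-cong l (λ i le → same i (above⇒notIn3 le)) occ) , unchanged
  where
  unchanged : UnchangedOutside o (3 + length l) s t
  unchanged m (inj₁ m<o)   = same m (below⇒notIn3 m<o)
  unchanged m (inj₂ end≤m) = same m (above⇒notIn3 (≤-trans (≤-reflexive (+-comm 3 o))
                               (≤-trans (+-monoʳ-≤ o (m≤m+n 3 (length l))) end≤m)))

liftMove : ∀ {u v} o (s : Seq) → KnuthMove u v → WordAt o u s →
  ∃[ t ] KnuthStep s t × WordAt o v t × UnchangedOutside o (length u) s t
liftMove o s (swapLastTwo {l = l} b) (refl , refl , refl , occ) =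
  swapAt (1 + o) (2 + o) s , (o , swapLast b (λ _ → refl)) ,
  rewriteWindow o l (swapAt-other (1 + o) (2 + o) s o (o≢1+o o) (o≢2+o o))
    (swapAt-fst (1 + o) (2 + o) s) (swapAt-snd (1 + o) (2 + o) s (o≢1+o (1 + o)))
    (λ m (_ , m≢o+1 , m≢o+2) → swapAt-other (1 + o) (2 + o) s m m≢o+1 m≢o+2) occ
liftMove o s (swapFirstTwo {l = l} b) (refl , refl , refl , occ) =
  swapAt o (1 + o) s , (o , swapFirst b (λ _ → refl)) ,
  rewriteWindow o l (swapAt-fst o (1 + o) s) (swapAt-snd o (1 + o) s (o≢1+o o))
    (swapAt-other o (1 + o) s (2 + o) (≢-sym (o≢2+o o)) (≢-sym (o≢1+o (1 + o))))
    (λ m (m≢o , m≢o+1 , _) → swapAt-other o (1 + o) s m m≢o m≢o+1) occ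
liftMove o s (skip x mv) (so≡x , occ) with liftMove (suc o) s mv occ
... | t , step , occ′ , unchanged =
  t , step , (trans (unchanged o (inj₁ (n<1+n o))) so≡x , occ′) ,
  λ m out → unchanged m (outside-suc out)

liftKnuth : ∀ {u v} o (s : Seq) → u ≈K v → WordAt o u s →
  ∃[ t ] Star KnuthStep s t × WordAt o v t × UnchangedOutside o (length u) s t
liftKnuth o s ε occ = s , ε , occ , λ _ _ → refl
liftKnuth o s (mv ◅ mvs) occ with liftMove o s mv occ
... | t₁ , step , occ₁ , unchanged₁ with liftKnuth o t₁ mvs occ₁
...   | t₂ , steps , occ₂ , unchanged₂ =
  t₂ , step ◅ steps , occ₂ ,
  λ m out → trans (unchanged₂ m (subst (λ len → Outside o len m) (↭-length (move⇒↭ mv)) out))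
                  (unchanged₁ m out)

ConvertedUpTo : Seq → Seq → ℕ → Seq → Set
ConvertedUpTo s b K c =
  Star KnuthStep s c × (∀ i → i < K → c i ≡ b i) × (∀ i → K ≤ i → c i ≡ s i)

convertBlock : ∀ {A B} o {s b c : Seq} → A ≈K B → WordAt o A s → WordAt o B b →
  ConvertedUpTo s b o c → ∃[ t ] ConvertedUpTo s b (o + length A) t
convertBlock {A} {B} o {s} {b} {c} A≈B occA occB (steps , before , after)
  with liftKnuth o c A≈B (wordAt-cong A after occA)
... | t , steps′ , occt , unchanged = t , steps ◅◅ steps′ , before′ , after′
  where
  before′ : ∀ i → i < o + length A → t i ≡ b i
  before′ i i<end with i <? o
  ... | yes i<o = trans (unchanged i (inj₁ i<o)) (before i i<o)
  ... | no  i≮o = wordAt-agree B occt occB i (≮⇒≥ i≮o)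
                    (subst (λ len → i < o + len) (↭-length (≈K⇒↭ A≈B)) i<end)
  after′ : ∀ i → o + length A ≤ i → t i ≡ s i
  after′ i end≤i = trans (unchanged i (inj₂ end≤i)) (after i (≤-trans (m≤m+n o (length A)) end≤i))

convertBlocks : ∀ {A B} n {s b : Seq} → length A ≡ n → A ≈K B →
  (∀ M → WordAt (M * n) A s) → (∀ M → WordAt (M * n) B b) →
  ∀ M → ∃[ c ] ConvertedUpTo s b (M * n) c
convertBlocks n         len A≈B occA occB zero    = _ , ε , (λ _ ()) , λ _ _ → refl
convertBlocks {A} n {s} {b} len A≈B occA occB (suc M) =
  subst (λ K → ∃[ c ] ConvertedUpTo s b K c) blockEnd
    (convertBlock (M * n) A≈B (occA M) (occB M)
      (proj₂ (convertBlocks n len A≈B occA occB M)))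
  where
  blockEnd : M * n + length A ≡ suc M * n
  blockEnd = trans (cong (M * n +_) len) (+-comm (M * n) n)

-- Hence such sequences are equivalent: to match a prefix of length N, convert
-- the first N blocks (each has length n ≥ 1).
blocks⇒equivalent : ∀ {A B} n .{{_ : NonZero n}} {s b : Seq} → length A ≡ n → A ≈K B →
  (∀ M → WordAt (M * n) A s) → (∀ M → WordAt (M * n) B b) → Equivalent s b
blocks⇒equivalent n len A≈B occA occB N with convertBlocks n len A≈B occA occB N
... | c , steps , before , _ = c , steps , λ i i<N → before i (<-≤-trans i<N (m≤m*n N n))

wordAt-tabulate : ∀ {k} (f : Fin k → ℕ) o (s : Seq) →
  (∀ j → s (o + toℕ j) ≡ f j) → WordAt o (tabulate f) s
wordAt-tabulate {zero}  f o s at = tt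
wordAt-tabulate {suc k} f o s at =
  trans (cong s (sym (+-identityʳ o))) (at fzero) ,
  wordAt-tabulate (f ∘ fsuc) (suc o) s (λ j → trans (cong s (sym (+-suc o (toℕ j)))) (at (fsuc j)))

periodic-blocks : ∀ n .{{_ : NonZero n}} (w : Permutation′ n) M →
  WordAt (M * n) (invWord w) (periodic w)
periodic-blocks n w M =
  subst (λ u → WordAt (M * n) u (periodic w)) (sym (map-tabulate id (invLetter w)))
    (wordAt-tabulate (invLetter w) (M * n) (periodic w)
      (λ j → cong (invLetter w) (toℕ-injective (trans (toℕ-fromℕ< _) (blockIndex j)))))
  where
  blockIndex : ∀ j → (M * n + toℕ j) % n ≡ toℕ j
  blockIndex j = trans (cong (_% n) (+-comm (M * n) (toℕ j)))
                   (trans ([m+kn]%n≡m%n (toℕ j) M n) (m<n⇒m%n≡m (toℕ<n j)))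

invWord-length : ∀ {n} (w : Permutation′ n) → length (invWord w) ≡ n
invWord-length {n} w = trans (length-map (invLetter w) (allFin n)) (length-tabulate id)

invWord-unique : ∀ {n} (w : Permutation′ n) → Unique (invWord w)
invWord-unique {n} w = Unique.map⁺ invLetter-injective (Unique.allFin⁺ n)
  where
  -- apply w⁻¹'s inverse w to both sides
  invLetter-injective : ∀ {i j} → invLetter w i ≡ invLetter w j → i ≡ j
  invLetter-injective same =
    trans (sym (inverseʳ w)) (trans (cong (w ⟨$⟩ʳ_) (toℕ-injective (suc-injective same))) (inverseʳ w))

proposition2p5 : (n : ℕ) .{{_ : NonZero n}} (w ŵ : Permutation′ n)
    → insertionTableau (invWord w) ≡ insertionTableau (invWord ŵ)
    → Equivalent (periodic w) (periodic ŵ)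
proposition2p5 n w ŵ sameTableau =
  blocks⇒equivalent n (invWord-length w) w⁻¹≈ŵ⁻¹ (periodic-blocks n w) (periodic-blocks n ŵ)
  where
  w⁻¹≈ŵ⁻¹ : invWord w ≈K invWord ŵ
  w⁻¹≈ŵ⁻¹ = sameTableau⇒≈K (invWord w) (invWord ŵ) (invWord-unique w) (invWord-unique ŵ) sameTableau
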